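{- Let $\psi_1,\psi_2$ be $k$-ary uniquely extendable commutative constraints on spin sets $\Omega_1$ and $\Omega_2$ respectively, and let $\theta:\Omega_1^k\to\Pi(\Omega_2)$ be symmetric. Then $\psi_1\times_\theta\psi_2$ is a $k$-ary uniquely extendable commutative constraint on $\Omega_1\times\Omega_2$.
   Context: A $k$-ary constraint on a set $S$ is a map $\psi:S^k\to\{0,1\}$; write $\sigma\models\psi$ if $\psi(\sigma)=1$. $\psi$ is uniquely extendable if for every $i\in[k]$ and every assignment of the other $k-1$ coordinates there is a unique element in coordinate $i$ making the tuple satisfy $\psi$; it is commutative if $\sigma\models\psi\iff(\sigma_{\pi(1)},\dots,\sigma_{\pi(k)})\models\psi$ for all $\sigma\in S^k$ and permutations $\pi$ of $[k]$. $\Pi(\Omega_2)$ is the group of permutations of $\Omega_2$. A map $\theta:\Omega_1^k\to\Pi(\Omega_2)$, written $\alpha\mapsto\theta_\alpha$, is symmetric if $\theta_{(\tau_1,\dots,\tau_k)}=\theta_{(\tau_{\pi(1)},\dots,\tau_{\pi(k)})}$ for all $\tau_i\in\Omega_1$ and permutations $\pi$ of $[k]$. The constraint $\psi_1\times_\theta\psi_2$ on $\Omega_1\times\Omega_2$ is defined by: for $\alpha=(\alpha_1,\dots,\alpha_k)\in\Omega_1^k$ and $(\beta_1,\dots,\beta_k)\in\Omega_2^k$, $((\alpha_1,\beta_1),\dots,(\alpha_k,\beta_k))\models\psi_1\times_\theta\psi_2$ iff $\alpha\models\psi_1$ and $(\theta_\alpha(\beta_1),\dots,\theta_\alpha(\beta_k))\models\psi_2$.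 -}

module Defs where

open import Data.Nat using (ℕ)
open import Data.Fin using (Fin)
open import Data.Bool using (Bool; true; _∧_)
open import Data.Vec using (Vec; lookup; tabulate; map; zip; unzip; _[_]≔_)
open import Data.Product using (_×_; _,_; proj₁; proj₂; ∃!)
open import Function.Bundles using (_↔_; Inverse)
open import Relation.Binary.PropositionalEquality using (_≡_)

Constraint : (S : Set) → ℕ → Set
Constraint S k = Vec S k → Bool

_⊨_ : ∀ {S k} → Vec S k → Constraint S k → Set
σ ⊨ ψ = ψ σ ≡ true

permute : ∀ {S : Set} {k} → (Fin k ↔ Fin k) → Vec S k → Vec S k
permute π σ = tabulate (λ i → lookup σ (Inverse.to π i))

-- uniquely extendable: for every i and every assignment of the other
-- coordinates, exactly one value in coordinate i satisfies ψ.
-- (The other coordinates are given by σ; its i-th entry is overwritten.)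
UniquelyExtendable : ∀ {S k} → Constraint S k → Set
UniquelyExtendable {S} {k} ψ =
  ∀ (i : Fin k) (σ : Vec S k) → ∃! _≡_ (λ (x : S) → (σ [ i ]≔ x) ⊨ ψ)

Commutative : ∀ {S k} → Constraint S k → Set
Commutative {S} {k} ψ =
  ∀ (σ : Vec S k) (π : Fin k ↔ Fin k) → (ψ σ ≡ true → ψ (permute π σ) ≡ true)
                                       × (ψ (permute π σ) ≡ true → ψ σ ≡ true)

Perm : Set → Set
Perm Ω = Ω ↔ Ω

Symmetric : ∀ {Ω₁ Ω₂ : Set} {k} → (Vec Ω₁ k → Perm Ω₂) → Set
Symmetric {Ω₁} {Ω₂} {k} θ =
  ∀ (τ : Vec Ω₁ k) (π : Fin k ↔ Fin k) (ω : Ω₂) →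
    Inverse.to (θ τ) ω ≡ Inverse.to (θ (permute π τ)) ω

_×[_]_ : ∀ {Ω₁ Ω₂ : Set} {k} → Constraint Ω₁ k → (Vec Ω₁ k → Perm Ω₂)
       → Constraint Ω₂ k → Constraint (Ω₁ × Ω₂) k
(ψ₁ ×[ θ ] ψ₂) ρ =
  ψ₁ (proj₁ (unzip ρ)) ∧ ψ₂ (map (Inverse.to (θ (proj₁ (unzip ρ)))) (proj₂ (unzip ρ)))

{-# OPTIONS --safe #-}
module Submission where

-- Writing a tuple ρ of pairs as (α , β) with α = map proj₁ ρ and β = map proj₂ ρ, the tuple
-- satisfies ψ₁ ×[ θ ] ψ₂ iff α satisfies ψ₁ and β satisfies ψ₂ ∘ map θ_α.  Changing coordinate i
-- of ρ to (a , b) therefore amounts to first choosing a (uniquely, by ψ₁) and then b (uniquely,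
-- since ψ₂ ∘ map θ_α is uniquely extendable whenever ψ₂ is, θ_α being a bijection).  Permuting ρ
-- permutes α and β, leaves θ_α unchanged by symmetry of θ, and permutation commutes with map θ_α.

open import Defs
open import Data.Nat using (ℕ)
open import Data.Fin using (Fin)
open import Data.Product using (_×_; _,_; proj₁; proj₂; ∃!)
open import Data.Vec using (Vec; []; _∷_; map; unzip; lookup; tabulate; _[_]≔_)
open import Data.Vec.Properties using (map-[]≔; map-cong; lookup-map; tabulate-∘; tabulate-cong)
open import Data.Bool using (Bool; true; false; _∧_)
open import Data.Bool.Properties using (⇔→≡)
open import Function.Base using (_∘_)
open import Function.Bundles using (_↔_; _⇔_; Inverse; Equivalence; mk⇔)
open import Function.Properties.Equivalence using () renaming (sym to ⇔-sym; trans to ⇔-trans)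
open import Relation.Binary.PropositionalEquality

private
  variable
    A B Ω Ω₁ Ω₂ : Set
    k : ℕ

∃!-cong : {P Q : A → Set} → (∀ x → P x ⇔ Q x) → ∃! _≡_ P → ∃! _≡_ Q
∃!-cong P⇔Q (x , p , unique) =
  x , Equivalence.to (P⇔Q x) p , λ {y} q → unique (Equivalence.from (P⇔Q y) q)

∃!-∘-↔ : {P : B → Set} (f : A ↔ B) → ∃! _≡_ P → ∃! _≡_ (P ∘ Inverse.to f)
∃!-∘-↔ {P = P} f (y , p , unique) = from y , p′ , unique′
  where
  open Inverse f
  p′ : P (to (from y))
  p′ = subst P (sym (strictlyInverseˡ y)) p
  unique′ : ∀ {x} → P (to x) → from y ≡ x
  unique′ {x} q = trans (cong from (unique q)) (strictlyInverseʳ x)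

∃!-× : {P : A → Set} {Q : A → B → Set} →
       ∃! _≡_ P → (∀ a → ∃! _≡_ (Q a)) → ∃! _≡_ (λ ((a , b) : A × B) → P a × Q a b)
∃!-× {P = P} {Q} (a , p , a-unique) ∃!Q with ∃!Q a
... | b , q , b-unique = (a , b) , (p , q) , λ (p′ , q′) → unique p′ q′
  where
  unique : ∀ {a′ b′} → P a′ → Q a′ b′ → (a , b) ≡ (a′ , b′)
  unique p′ q′ with a-unique p′
  ... | refl = cong (a ,_) (b-unique q′)

≡true-resp : {x y : Bool} → x ≡ y → (x ≡ true) ⇔ (y ≡ true)
≡true-resp x≡y = mk⇔ (trans (sym x≡y)) (trans x≡y)

∧≡true⇔ : {x y : Bool} → (x ∧ y ≡ true) ⇔ (x ≡ true × y ≡ true)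
∧≡true⇔ {true}  = mk⇔ (refl ,_) proj₂
∧≡true⇔ {false} = mk⇔ (λ ()) (λ ())

unzip-as-maps : ∀ {n} (ρ : Vec (A × B) n) → unzip ρ ≡ (map proj₁ ρ , map proj₂ ρ)
unzip-as-maps []      = refl
unzip-as-maps (x ∷ ρ) rewrite unzip-as-maps ρ = refl

map-permute : (f : A → B) (π : Fin k ↔ Fin k) (σ : Vec A k) →
              map f (permute π σ) ≡ permute π (map f σ)
map-permute f π σ = begin
  map f (tabulate (lookup σ ∘ Inverse.to π))   ≡⟨ tabulate-∘ f _ ⟨
  tabulate (f ∘ lookup σ ∘ Inverse.to π)       ≡⟨ tabulate-cong (λ i → lookup-map (Inverse.to π i) f σ) ⟨
  tabulate (lookup (map f σ) ∘ Inverse.to π)   ∎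
  where open ≡-Reasoning

Commutative⇒permute-invariant : {ψ : Constraint A k} → Commutative ψ →
                                ∀ π σ → ψ (permute π σ) ≡ ψ σ
Commutative⇒permute-invariant ψ-comm π σ = ⇔→≡ (mk⇔ (proj₂ (ψ-comm σ π)) (proj₁ (ψ-comm σ π)))

permute-invariant⇒Commutative : {ψ : Constraint A k} →
                                (∀ π σ → ψ (permute π σ) ≡ ψ σ) → Commutative ψ
permute-invariant⇒Commutative invariant σ π = trans (invariant π σ) , trans (sym (invariant π σ))

∘map-uniquelyExtendable : {ψ : Constraint Ω k} (f : Perm Ω) →
                          UniquelyExtendable ψ → UniquelyExtendable (ψ ∘ map (Inverse.to f))
∘map-uniquelyExtendable {ψ = ψ} f ψ-ue i σ =
  ∃!-cong (λ x → ≡true-resp (cong ψ (sym (map-[]≔ to σ i))))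
          (∃!-∘-↔ f (ψ-ue i (map to σ)))
  where open Inverse f

module _ (ψ₁ : Constraint Ω₁ k) (ψ₂ : Constraint Ω₂ k) (θ : Vec Ω₁ k → Perm Ω₂) where

  twist : Vec Ω₁ k → Constraint Ω₂ k
  twist α = ψ₂ ∘ map (Inverse.to (θ α))

  ×[]-unzip : ∀ ρ → (ψ₁ ×[ θ ] ψ₂) ρ ≡ ψ₁ (map proj₁ ρ) ∧ twist (map proj₁ ρ) (map proj₂ ρ)
  ×[]-unzip ρ rewrite unzip-as-maps ρ = refl

  ⊨-×[]-[]≔ : ∀ ρ i a b →
              (ρ [ i ]≔ (a , b)) ⊨ (ψ₁ ×[ θ ] ψ₂)
              ⇔ ((map proj₁ ρ [ i ]≔ a) ⊨ ψ₁ × (map proj₂ ρ [ i ]≔ b) ⊨ twist (map proj₁ ρ [ i ]≔ a))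
  ⊨-×[]-[]≔ ρ i a b = ⇔-trans (≡true-resp unzipped) ∧≡true⇔
    where
    unzipped : (ψ₁ ×[ θ ] ψ₂) (ρ [ i ]≔ (a , b))
             ≡ ψ₁ (map proj₁ ρ [ i ]≔ a) ∧ twist (map proj₁ ρ [ i ]≔ a) (map proj₂ ρ [ i ]≔ b)
    unzipped = trans (×[]-unzip (ρ [ i ]≔ (a , b)))
                     (cong₂ (λ α β → ψ₁ α ∧ twist α β) (map-[]≔ proj₁ ρ i) (map-[]≔ proj₂ ρ i))

  ×[]-uniquelyExtendable : UniquelyExtendable ψ₁ → UniquelyExtendable ψ₂ →
                           UniquelyExtendable (ψ₁ ×[ θ ] ψ₂)
  ×[]-uniquelyExtendable ψ₁-ue ψ₂-ue i ρ =
    ∃!-cong (λ (a , b) → ⇔-sym (⊨-×[]-[]≔ ρ i a b))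
            (∃!-× (ψ₁-ue i α)
                  (λ a → ∘map-uniquelyExtendable {ψ = ψ₂} (θ (α [ i ]≔ a)) ψ₂-ue i (map proj₂ ρ)))
    where α = map proj₁ ρ

  twist-permute : Commutative ψ₂ → Symmetric θ →
                  ∀ π α β → twist (permute π α) (permute π β) ≡ twist α β
  twist-permute ψ₂-comm θ-sym π α β = begin
    ψ₂ (map (Inverse.to (θ (permute π α))) (permute π β)) ≡⟨ cong ψ₂ (map-cong (θ-sym α π) _) ⟨
    ψ₂ (map (Inverse.to (θ α)) (permute π β))             ≡⟨ cong ψ₂ (map-permute _ π β) ⟩
    ψ₂ (permute π (map (Inverse.to (θ α)) β))             ≡⟨ Commutative⇒permute-invariant ψ₂-comm π _ ⟩
    ψ₂ (map (Inverse.to (θ α)) β)                         ∎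
    where open ≡-Reasoning

  ×[]-commutative : Commutative ψ₁ → Commutative ψ₂ → Symmetric θ → Commutative (ψ₁ ×[ θ ] ψ₂)
  ×[]-commutative ψ₁-comm ψ₂-comm θ-sym = permute-invariant⇒Commutative invariant
    where
    open ≡-Reasoning
    invariant : ∀ π ρ → (ψ₁ ×[ θ ] ψ₂) (permute π ρ) ≡ (ψ₁ ×[ θ ] ψ₂) ρ
    invariant π ρ = begin
      (ψ₁ ×[ θ ] ψ₂) (permute π ρ)
        ≡⟨ ×[]-unzip (permute π ρ) ⟩
      ψ₁ (map proj₁ (permute π ρ)) ∧ twist (map proj₁ (permute π ρ)) (map proj₂ (permute π ρ))
        ≡⟨ cong₂ (λ α β → ψ₁ α ∧ twist α β) (map-permute proj₁ π ρ) (map-permute proj₂ π ρ) ⟩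
      ψ₁ (permute π α) ∧ twist (permute π α) (permute π β)
        ≡⟨ cong₂ _∧_ (Commutative⇒permute-invariant ψ₁-comm π α) (twist-permute ψ₂-comm θ-sym π α β) ⟩
      ψ₁ α ∧ twist α β
        ≡⟨ ×[]-unzip ρ ⟨
      (ψ₁ ×[ θ ] ψ₂) ρ ∎
      where
      α = map proj₁ ρ
      β = map proj₂ ρ

lemma5p2 : (k n₁ n₂ : ℕ) (ψ₁ : Constraint (Fin n₁) k) (ψ₂ : Constraint (Fin n₂) k)
           (θ : Vec (Fin n₁) k → Perm (Fin n₂))
           → UniquelyExtendable ψ₁ → Commutative ψ₁
           → UniquelyExtendable ψ₂ → Commutative ψ₂
           → Symmetric θ
           → UniquelyExtendable (ψ₁ ×[ θ ] ψ₂) × Commutative (ψ₁ ×[ θ ] ψ₂)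
lemma5p2 k n₁ n₂ ψ₁ ψ₂ θ ψ₁-ue ψ₁-comm ψ₂-ue ψ₂-comm θ-sym =
  ×[]-uniquelyExtendable ψ₁ ψ₂ θ ψ₁-ue ψ₂-ue , ×[]-commutative ψ₁ ψ₂ θ ψ₁-comm ψ₂-comm θ-sym
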